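{- Let $T$ be a set of rooted binary phylogenetic trees on the same leaf set $X$ and let $C$ be a constraint set on $T$. If a cherry picking sequence $s$ for $T$ satisfies $C$, then $w_T(s)\ge P(C)$, where $P(C)=\psi\,|C|+(1-2\psi)\,|\pi_1(C)|$ and $\psi=\frac{\log 2}{\log 5}$.
   Context: A tree is a rooted binary phylogenetic $X$-tree. $\mathcal{T}\setminus A$ is obtained by deleting the leaves in $A$ and repeatedly suppressing vertices with in- and out-degree one; $T\setminus A=\{\mathcal{T}\setminus A:\mathcal{T}\in T\}$. A cherry is a pair of leaves with a common parent; $(a,b)\in\mathcal{T}$ (symmetric) means $\{a,b\}$ is a cherry of $\mathcal{T}$; $(a,b)\in T$ means it is a cherry of some tree in $T$. $H(T)$ is the set of leaves in a cherry in every tree of $T$. $N_T(x)=\{y:(y,x)\in\mathcal{T}\text{ for some }\mathcal{T}\in T\}$, $w_T(x)=|N_T(x)|-1$. A cherry picking sequence for $T$ is a sequence $s=(s_1,\dots,s_n)$ containing each leaf exactly once with $s_i\in H(T\setminus\{s_1,\dots,s_{i-1}\})$ for $i\le n-1$; its weight is $w_T(s)=\sum_{i=1}^{n-1}w_{T\setminus\{s_1,\dots,s_{i-1}\}}(s_i)$. A constraint set on $T$ is $C\subseteq X\times X$ with every pair a cherry in $T$; $s$ satisfies $C$ if for every $(a,b)\in C$ there is $i$ with $s_i=a$, $(a,b)\in T'$ and $w_{T'}(a)>0$, where $T'=T\setminus\{s_1,\dots,s_{i-1}\}$. $\pi_1(C)=\{a:(a,b)\in C\}$. -}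

module Defs where

open import Data.Nat using (ℕ; _≟_; _∸_; _+_; _*_; _^_; _≤_; _<_)
open import Data.List using (List; []; _∷_; length; map; concatMap; mapMaybe; deduplicate; _++_)
open import Data.Maybe using (Maybe; just; nothing)
open import Data.Product using (_×_; _,_; ∃; proj₁; proj₂)
open import Data.List.Relation.Unary.All using (All)
open import Data.List.Relation.Unary.Any using (Any)
open import Data.Unit using (⊤)
open import Relation.Nullary using (yes; no)

-- Rooted binary phylogenetic trees with leaves labelled by naturals.
-- (Children are unordered mathematically; all notions below are
-- invariant under swapping children.)
data Tree : Set where
  leaf : ℕ → Tree
  node : Tree → Tree → Tree

leaves : Tree → List ℕ
leaves (leaf x)   = x ∷ []
leaves (node l r) = leaves l ++ leaves r

-- Deleting a leaf and suppressing the resulting degree-one vertex.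
-- nothing = empty tree (all leaves deleted).
delLeaf : ℕ → Tree → Maybe Tree
delLeaf a (leaf x) with x ≟ a
... | yes _ = nothing
... | no _  = just (leaf x)
delLeaf a (node l r) with delLeaf a l | delLeaf a r
... | nothing | nothing = nothing
... | nothing | just r' = just r'
... | just l' | nothing = just l'
... | just l' | just r' = just (node l' r')

TreeSet : Set
TreeSet = List Tree

delSet1 : ℕ → TreeSet → TreeSet
delSet1 a T = mapMaybe (delLeaf a) T

data CherryOf (a b : ℕ) : Tree → Set where
  here  : CherryOf a b (node (leaf a) (leaf b))
  here' : CherryOf a b (node (leaf b) (leaf a))
  left  : ∀ {l r} → CherryOf a b l → CherryOf a b (node l r)
  right : ∀ {l r} → CherryOf a b r → CherryOf a b (node l r)

CherryIn : TreeSet → ℕ → ℕ → Set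
CherryIn T a b = Any (CherryOf a b) T

InH : TreeSet → ℕ → Set
InH T x = All (λ t → ∃ λ y → CherryOf x y t) T

pairPart : ℕ → Tree → Tree → List ℕ
pairPart x (leaf a) (leaf b) with a ≟ x | b ≟ x
... | yes _ | _     = b ∷ []
... | no _  | yes _ = a ∷ []
... | no _  | no _  = []
pairPart x _ _ = []

partners : ℕ → Tree → List ℕ
partners x (leaf _)   = []
partners x (node l r) = pairPart x l r ++ (partners x l ++ partners x r)

NT : TreeSet → ℕ → List ℕ
NT T x = deduplicate _≟_ (concatMap (partners x) T)

-- w_T(x) = |N_T(x)| - 1  (truncated; only used when |N_T(x)| ≥ 1)
wT : TreeSet → ℕ → ℕ
wT T x = length (NT T x) ∸ 1

CPS : TreeSet → List ℕ → Set
CPS T []            = ⊤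
CPS T (x ∷ [])      = ⊤
CPS T (x ∷ y ∷ rest) = InH T x × CPS (delSet1 x T) (y ∷ rest)

weight : TreeSet → List ℕ → ℕ
weight T []             = 0
weight T (x ∷ [])       = 0
weight T (x ∷ y ∷ rest) = wT T x + weight (delSet1 x T) (y ∷ rest)

data PickedWith (a b : ℕ) : TreeSet → List ℕ → Set where
  now   : ∀ {T rest} → CherryIn T a b → 0 < wT T a → PickedWith a b T (a ∷ rest)
  later : ∀ {T x rest} → PickedWith a b (delSet1 x T) rest → PickedWith a b T (x ∷ rest)

Satisfies : TreeSet → List ℕ → List (ℕ × ℕ) → Set
Satisfies T s C = All (λ p → PickedWith (proj₁ p) (proj₂ p) T s) C

IsConstraintSet : TreeSet → List (ℕ × ℕ) → Set
IsConstraintSet T C = All (λ p → CherryIn T (proj₁ p) (proj₂ p)) C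

π₁ : List (ℕ × ℕ) → List ℕ
π₁ C = deduplicate _≟_ (map proj₁ C)

-- w ≥ ψ c + (1 - 2ψ) p  with ψ = log 2 / log 5, for naturals w c p.
-- Multiplying by log 5 > 0 and exponentiating (exp monotone):
--   w log5 ≥ c log2 + p log5 - 2p log2  ⇔  2^c * 5^p ≤ 5^w * 4^p.
PsiBound : ℕ → ℕ → ℕ → Set
PsiBound w c p = 2 ^ c * 5 ^ p ≤ 5 ^ w * 4 ^ p

{-# OPTIONS --safe #-}
module Submission where

-- Split s = x ∷ s′ and C into the constraints picked at x and those satisfied by s′ on
-- T \ {x}. The former are pairs (x , b) with distinct b ∈ N_T(x); if there are k ≥ 1 of
-- them then w_T(x) ≥ 1 and k ≤ w_T(x) + 1, while they add k to |C| and at most 1 to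
-- |π₁(C)|. In its exponentiated form the bound is additive in (w, |C|, |π₁(C)|) and
-- antitone in |π₁(C)|, so by induction on s it remains to check ψ k + (1 − 2ψ) ≤ w_T(x),
-- i.e. 2^(w+1) · 5 ≤ 5^w · 4 for w ≥ 1, which is an equality at w = 1. The last leaf of
-- s is then the only leaf of every tree, so it has weight 0 and picks no constraint.

open import Defs
open import Data.Nat using (ℕ; zero; suc; _+_; _*_; _^_; _≤_; _<_; _≤′_; ≤′-refl; ≤′-step; z≤n; s≤s; _≟_)
open import Data.Nat.Properties
open import Data.List using (List; []; _∷_; [_]; length; _++_; map; concatMap)
open import Data.List.Properties using (length-++; length-map)
open import Data.Product using (_×_; _,_; proj₁; proj₂; ∃; ∃₂)
import Data.Product as Product
open import Data.Sum using (_⊎_; inj₁; inj₂; [_,_]′)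
open import Data.Maybe using (just; nothing)
open import Data.List.Relation.Unary.All as All using (All; []; _∷_)
open import Data.List.Relation.Unary.All.Properties using (++⁻ˡ)
open import Data.List.Relation.Unary.Any as Any using (here; there)
open import Data.List.Relation.Unary.AllPairs using ([]; _∷_)
open import Data.List.Relation.Unary.Unique.Propositional using (Unique)
open import Data.List.Relation.Unary.Unique.DecPropositional.Properties _≟_ using (deduplicate-!)
open import Data.List.Relation.Binary.Subset.Propositional using (_⊆_)
open import Data.List.Relation.Binary.Subset.Propositional.Properties using (++⁺; ⊆-reflexive-↭)
open import Data.List.Relation.Binary.Permutation.Propositional using (_↭_; ↭-sym; ↭-trans; ↭⇒↭ₛ)
open import Data.List.Relation.Binary.Permutation.Propositional.Properties using (∈-resp-↭; ↭-length; shift)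
open import Data.List.Relation.Ternary.Interleaving.Propositional using (Interleaving; []; consˡ; consʳ; toPermutation)
open import Data.List.Relation.Ternary.Interleaving.Properties using (interleave-length)
open import Data.List.Membership.Propositional using (_∈_)
open import Data.List.Membership.Propositional.Properties
  using (∈-∃++; ∈-++⁻; ∈-++⁺ˡ; ∈-++⁺ʳ; ∈-map⁺; ∈-map⁻; ∈-concatMap⁺; ∈-concatMap⁻; ∈-deduplicate⁺; ∈-deduplicate⁻)
open import Relation.Binary.PropositionalEquality using (_≡_; _≢_; refl; sym; cong; cong₂; subst₂; setoid)
open import Relation.Nullary using (yes; no; contradiction)
import Data.List.Relation.Binary.Permutation.Setoid.Properties as PermutationₛProperties
open import Algebra.Properties.CommutativeSemigroup *-commutativeSemigroup using (x∙yz≈y∙xz)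

-- PsiBound wrapped in a record, so that w, c and p can be inferred from a bound.
record PsiBounded (w c p : ℕ) : Set where
  constructor bounded
  field unwrap : PsiBound w c p

PsiBounded-zero : ∀ w → PsiBounded w 0 0
PsiBounded-zero w = bounded (*-monoˡ-≤ 1 (m^n>0 5 w))

PsiBounded-+ : ∀ {w c p w′ c′ p′} → PsiBounded w c p → PsiBounded w′ c′ p′
             → PsiBounded (w + w′) (c + c′) (p + p′)
PsiBounded-+ {w} {c} {p} {w′} {c′} {p′} (bounded h) (bounded h′) = bounded (begin
  2 ^ (c + c′) * 5 ^ (p + p′)          ≡⟨ cong₂ _*_ (^-distribˡ-+-* 2 c c′) (^-distribˡ-+-* 5 p p′) ⟩
  (2 ^ c * 2 ^ c′) * (5 ^ p * 5 ^ p′)  ≡⟨ [m*n]*[o*p]≡[m*o]*[n*p] (2 ^ c) (2 ^ c′) (5 ^ p) (5 ^ p′) ⟩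
  (2 ^ c * 5 ^ p) * (2 ^ c′ * 5 ^ p′)  ≤⟨ *-mono-≤ h h′ ⟩
  (5 ^ w * 4 ^ p) * (5 ^ w′ * 4 ^ p′)  ≡⟨ [m*n]*[o*p]≡[m*o]*[n*p] (5 ^ w) (5 ^ w′) (4 ^ p) (4 ^ p′) ⟨
  (5 ^ w * 5 ^ w′) * (4 ^ p * 4 ^ p′)  ≡⟨ cong₂ _*_ (^-distribˡ-+-* 5 w w′) (^-distribˡ-+-* 4 p p′) ⟨
  5 ^ (w + w′) * 4 ^ (p + p′)          ∎)
  where open ≤-Reasoning

PsiBounded-pred : ∀ {w c p} → PsiBounded w c (suc p) → PsiBounded w c p
PsiBounded-pred {w} {c} {p} (bounded h) = bounded (*-cancelˡ-≤ 4 (begin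
  4 * (2 ^ c * 5 ^ p)  ≤⟨ *-monoˡ-≤ (2 ^ c * 5 ^ p) (n≤1+n 4) ⟩
  5 * (2 ^ c * 5 ^ p)  ≡⟨ x∙yz≈y∙xz 5 (2 ^ c) (5 ^ p) ⟩
  2 ^ c * 5 ^ suc p    ≤⟨ h ⟩
  5 ^ w * 4 ^ suc p    ≡⟨ x∙yz≈y∙xz (5 ^ w) 4 (4 ^ p) ⟩
  4 * (5 ^ w * 4 ^ p)  ∎))
  where open ≤-Reasoning

PsiBounded-antitone : ∀ {w c p q} → p ≤ q → PsiBounded w c q → PsiBounded w c p
PsiBounded-antitone p≤q = go (≤⇒≤′ p≤q)
  where
  go : ∀ {w c p q} → p ≤′ q → PsiBounded w c q → PsiBounded w c p
  go ≤′-refl         h = h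
  go (≤′-step p≤′q) h = go p≤′q (PsiBounded-pred h)

2^[2+n]*5≤5^[1+n]*4 : ∀ n → 2 ^ (2 + n) * 5 ≤ 5 ^ (1 + n) * 4
2^[2+n]*5≤5^[1+n]*4 zero    = ≤-refl
2^[2+n]*5≤5^[1+n]*4 (suc n) = begin
  (2 * 2 ^ (2 + n)) * 5  ≡⟨ *-assoc 2 (2 ^ (2 + n)) 5 ⟩
  2 * (2 ^ (2 + n) * 5)  ≤⟨ *-mono-≤ (m≤m+n 2 3) (2^[2+n]*5≤5^[1+n]*4 n) ⟩
  5 * (5 ^ (1 + n) * 4)  ≡⟨ *-assoc 5 (5 ^ (1 + n)) 4 ⟨
  (5 * 5 ^ (1 + n)) * 4  ∎
  where open ≤-Reasoning

PsiBounded-cherries : ∀ {w c} → c ≤ suc w → 0 < w → PsiBounded w c 1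
PsiBounded-cherries {suc n} {c} c≤2+n _ = bounded (begin
  2 ^ c * 5        ≤⟨ *-monoˡ-≤ 5 (^-monoʳ-≤ 2 c≤2+n) ⟩
  2 ^ (2 + n) * 5  ≤⟨ 2^[2+n]*5≤5^[1+n]*4 n ⟩
  5 ^ (1 + n) * 4  ∎)
  where open ≤-Reasoning

⊆∧Unique⇒length≤ : ∀ {A : Set} {xs ys : List A} → Unique xs → xs ⊆ ys → length xs ≤ length ys
⊆∧Unique⇒length≤ {xs = []}     _            _     = z≤n
⊆∧Unique⇒length≤ {xs = x ∷ xs} (x∉xs ∷ !xs) xs⊆ys
  with as , bs , refl ← ∈-∃++ (xs⊆ys (here refl)) = begin
    suc (length xs)          ≤⟨ s≤s (⊆∧Unique⇒length≤ !xs xs⊆as++bs) ⟩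
    suc (length (as ++ bs))  ≡⟨ ↭-length (shift x as bs) ⟨
    length (as ++ x ∷ bs)    ∎
  where
  open ≤-Reasoning
  xs⊆as++bs : xs ⊆ as ++ bs
  xs⊆as++bs z∈xs with ∈-resp-↭ (shift x as bs) (xs⊆ys (there z∈xs))
  ... | here refl = contradiction refl (All.lookup x∉xs z∈xs)
  ... | there z∈  = z∈

Unique-++⁻ : ∀ {A : Set} (xs : List A) {ys} → Unique (xs ++ ys) → Unique xs × Unique ys
Unique-++⁻ []       !ys          = [] , !ys
Unique-++⁻ (x ∷ xs) (x∉ ∷ !xsys) = Product.map₁ (++⁻ˡ xs x∉ ∷_) (Unique-++⁻ xs !xsys)

Unique-interleaving : ∀ {A : Set} {xs ys zs : List A} → Interleaving ys zs xs → Unique xs → Unique ys × Unique zs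
Unique-interleaving {A} {ys = ys} ys⋈zs !xs =
  Unique-++⁻ ys (Unique-resp-↭ (↭⇒↭ₛ (toPermutation ys⋈zs)) !xs)
  where open PermutationₛProperties (setoid A) using (Unique-resp-↭)

partition-All⊎ : ∀ {A : Set} {P Q : A → Set} {xs} → All (λ x → P x ⊎ Q x) xs
               → ∃₂ λ ys zs → Interleaving ys zs xs × All P ys × All Q zs
partition-All⊎ [] = [] , [] , [] , [] , []
partition-All⊎ (inj₁ px ∷ pqs) with ys , zs , ys⋈zs , ps , qs ← partition-All⊎ pqs =
  _ ∷ ys , zs , consˡ ys⋈zs , px ∷ ps , qs
partition-All⊎ (inj₂ qx ∷ pqs) with ys , zs , ys⋈zs , ps , qs ← partition-All⊎ pqs =
  ys , _ ∷ zs , consʳ ys⋈zs , ps , qx ∷ qs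

∈-π₁⁺ : ∀ {q C} → q ∈ C → proj₁ q ∈ π₁ C
∈-π₁⁺ q∈C = ∈-deduplicate⁺ _≟_ (∈-map⁺ proj₁ q∈C)

∈-π₁⁻ : ∀ {a C} → a ∈ π₁ C → ∃ λ q → q ∈ C × a ≡ proj₁ q
∈-π₁⁻ {C = C} a∈π₁C = ∈-map⁻ proj₁ (∈-deduplicate⁻ _≟_ (map proj₁ C) a∈π₁C)

length-π₁-interleaving : ∀ {C D E} → Interleaving C D E → length (π₁ E) ≤ length (π₁ C) + length (π₁ D)
length-π₁-interleaving {C} {D} {E} C⋈D = begin
  length (π₁ E)            ≤⟨ ⊆∧Unique⇒length≤ (deduplicate-! (map proj₁ E)) π₁E⊆π₁C++π₁D ⟩
  length (π₁ C ++ π₁ D)    ≡⟨ length-++ (π₁ C) ⟩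
  length (π₁ C) + length (π₁ D) ∎
  where
  open ≤-Reasoning
  π₁E⊆π₁C++π₁D : π₁ E ⊆ π₁ C ++ π₁ D
  π₁E⊆π₁C++π₁D a∈ with q , q∈E , refl ← ∈-π₁⁻ a∈ =
    [ (λ q∈C → ∈-++⁺ˡ (∈-π₁⁺ q∈C)) , (λ q∈D → ∈-++⁺ʳ (π₁ C) (∈-π₁⁺ q∈D)) ]′
      (∈-++⁻ C (∈-resp-↭ (toPermutation C⋈D) q∈E))

++-⊆ : ∀ {A : Set} {xs ys zs : List A} → xs ⊆ zs → ys ⊆ zs → xs ++ ys ⊆ zs
++-⊆ {xs = xs} xs⊆zs ys⊆zs v∈ = [ xs⊆zs , ys⊆zs ]′ (∈-++⁻ xs v∈)

pairPart⊆leaves : ∀ x l r → pairPart x l r ⊆ leaves l ++ leaves r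
pairPart⊆leaves x (leaf a) (leaf b) v∈ with a ≟ x | b ≟ x
pairPart⊆leaves x (leaf a) (leaf b) (here refl) | yes _ | _     = there (here refl)
pairPart⊆leaves x (leaf a) (leaf b) (here refl) | no _  | yes _ = here refl
pairPart⊆leaves x (leaf a) (leaf b) ()          | no _  | no _
pairPart⊆leaves x (leaf _) (node _ _) ()
pairPart⊆leaves x (node _ _) _ ()

partners⊆leaves : ∀ x t → partners x t ⊆ leaves t
partners⊆leaves x (leaf _) ()
partners⊆leaves x (node l r) =
  ++-⊆ (pairPart⊆leaves x l r) (++⁺ (partners⊆leaves x l) (partners⊆leaves x r))

CherryOf⇒∈partners : ∀ {x b t} → CherryOf x b t → b ∈ partners x t
CherryOf⇒∈partners {x} here with x ≟ x
... | yes _   = here refl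
... | no x≢x  = contradiction refl x≢x
CherryOf⇒∈partners {x} {b} here' with b ≟ x | x ≟ x
... | yes b≡x | _       = here b≡x
... | no _    | yes _   = here refl
... | no _    | no x≢x  = contradiction refl x≢x
CherryOf⇒∈partners {x} (left {l} {r} c)  =
  ∈-++⁺ʳ (pairPart x l r) (∈-++⁺ˡ (CherryOf⇒∈partners c))
CherryOf⇒∈partners {x} (right {l} {r} c) =
  ∈-++⁺ʳ (pairPart x l r) (∈-++⁺ʳ (partners x l) (CherryOf⇒∈partners c))

CherryIn⇒∈NT : ∀ {T x b} → CherryIn T x b → b ∈ NT T x
CherryIn⇒∈NT {x = x} ch = ∈-deduplicate⁺ _≟_ (∈-concatMap⁺ (partners x) (Any.map CherryOf⇒∈partners ch))

∈-leaves-delLeaf : ∀ {a} t {t′ z} → delLeaf a t ≡ just t′ → z ∈ leaves t′ → z ∈ leaves t × z ≢ a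
∈-leaves-delLeaf {a} (leaf x) eq z∈ with x ≟ a
∈-leaves-delLeaf (leaf x) () _           | yes _
∈-leaves-delLeaf (leaf x) refl (here refl) | no x≢a = here refl , x≢a
∈-leaves-delLeaf {a} (node l r) eq z∈ with delLeaf a l in eqˡ | delLeaf a r in eqʳ
∈-leaves-delLeaf (node l r) () _    | nothing | nothing
∈-leaves-delLeaf (node l r) refl z∈ | nothing | just _  =
  Product.map₁ (∈-++⁺ʳ (leaves l)) (∈-leaves-delLeaf r eqʳ z∈)
∈-leaves-delLeaf (node l r) refl z∈ | just _  | nothing =
  Product.map₁ ∈-++⁺ˡ (∈-leaves-delLeaf l eqˡ z∈)
∈-leaves-delLeaf (node l r) refl z∈ | just l′ | just _  =
  [ (λ z∈l′ → Product.map₁ ∈-++⁺ˡ (∈-leaves-delLeaf l eqˡ z∈l′))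
  , (λ z∈r′ → Product.map₁ (∈-++⁺ʳ (leaves l)) (∈-leaves-delLeaf r eqʳ z∈r′)) ]′ (∈-++⁻ (leaves l′) z∈)

LeavesWithin : TreeSet → List ℕ → Set
LeavesWithin T s = All (λ t → leaves t ⊆ s) T

LeavesWithin-delSet1 : ∀ {T x s} → LeavesWithin T (x ∷ s) → LeavesWithin (delSet1 x T) s
LeavesWithin-delSet1 [] = []
LeavesWithin-delSet1 {t ∷ _} {x} {s} (t⊆x∷s ∷ T⊆x∷s) with delLeaf x t in eq
... | nothing = LeavesWithin-delSet1 T⊆x∷s
... | just t′ = t′⊆s ∷ LeavesWithin-delSet1 T⊆x∷s
  where
  t′⊆s : leaves t′ ⊆ s
  t′⊆s z∈t′ with z∈t , z≢x ← ∈-leaves-delLeaf t eq z∈t′ with t⊆x∷s z∈t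
  ... | here z≡x = contradiction z≡x z≢x
  ... | there z∈s = z∈s

NT⊆ : ∀ {T s} x → LeavesWithin T s → NT T x ⊆ s
NT⊆ {T} x T⊆s z∈NT = All.lookupWith (λ {t} t⊆s z∈pt → t⊆s (partners⊆leaves x t z∈pt)) T⊆s
  (∈-concatMap⁻ (partners x) (∈-deduplicate⁻ _≟_ (concatMap (partners x) T) z∈NT))

wT-last : ∀ {T x} → LeavesWithin T [ x ] → wT T x ≡ 0
wT-last {T} {x} T⊆[x] = m≤n⇒m∸n≡0 (⊆∧Unique⇒length≤ (deduplicate-! (concatMap (partners x) T)) (NT⊆ x T⊆[x]))

weight-∷ : ∀ {T x} s → LeavesWithin T (x ∷ s) → weight T (x ∷ s) ≡ wT T x + weight (delSet1 x T) s
weight-∷ []      T⊆[x] = sym (cong (_+ 0) (wT-last T⊆[x]))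
weight-∷ (_ ∷ _) _     = refl

PickedNow : TreeSet → ℕ → ℕ × ℕ → Set
PickedNow T x q = proj₁ q ≡ x × CherryIn T (proj₁ q) (proj₂ q) × 0 < wT T x

picked-now-or-later : ∀ {a b T x s} → PickedWith a b T (x ∷ s)
                    → PickedNow T x (a , b) ⊎ PickedWith a b (delSet1 x T) s
picked-now-or-later (now ch w>0) = inj₁ (refl , ch , w>0)
picked-now-or-later (later p)    = inj₂ p

PickedNow⇒∈ : ∀ {T x q} → PickedNow T x q → q ∈ map (x ,_) (NT T x)
PickedNow⇒∈ (refl , ch , _) = ∈-map⁺ _ (CherryIn⇒∈NT ch)

PsiBounded-pickedNow : ∀ {T x D} → Unique D → All (PickedNow T x) D
                     → PsiBounded (wT T x) (length D) (length (π₁ D))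
PsiBounded-pickedNow {T} {x} [] [] = PsiBounded-zero (wT T x)
PsiBounded-pickedNow {T} {x} {D} !D picks@((_ , _ , w>0) ∷ _) =
  PsiBounded-antitone |π₁D|≤1 (PsiBounded-cherries |D|≤1+w w>0)
  where
  open ≤-Reasoning
  |D|≤1+w : length D ≤ suc (wT T x)
  |D|≤1+w = begin
    length D                      ≤⟨ ⊆∧Unique⇒length≤ !D (λ q∈D → PickedNow⇒∈ (All.lookup picks q∈D)) ⟩
    length (map (x ,_) (NT T x))  ≡⟨ length-map (x ,_) (NT T x) ⟩
    length (NT T x)               ≤⟨ m≤n+m∸n (length (NT T x)) 1 ⟩
    suc (wT T x)                  ∎
  π₁D⊆[x] : π₁ D ⊆ [ x ]
  π₁D⊆[x] a∈π₁D with q , q∈D , refl ← ∈-π₁⁻ a∈π₁D = here (proj₁ (All.lookup picks q∈D))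
  |π₁D|≤1 : length (π₁ D) ≤ 1
  |π₁D|≤1 = ⊆∧Unique⇒length≤ (deduplicate-! (map proj₁ D)) π₁D⊆[x]

Satisfies⇒PsiBounded : ∀ {T s C} → Unique C → LeavesWithin T s → Satisfies T s C
                     → PsiBounded (weight T s) (length C) (length (π₁ C))
Satisfies⇒PsiBounded {s = []} _ _ []       = bounded ≤-refl
Satisfies⇒PsiBounded {s = []} _ _ (() ∷ _)
Satisfies⇒PsiBounded {T} {x ∷ s} {C} !C T⊆x∷s sat
  with Cₙ , Cₗ , Cₙ⋈Cₗ , pickedNow , pickedLater ← partition-All⊎ (All.map picked-now-or-later sat)
  with !Cₙ , !Cₗ ← Unique-interleaving Cₙ⋈Cₗ !C =
  subst₂ (λ w c → PsiBounded w c (length (π₁ C)))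
         (sym (weight-∷ s T⊆x∷s)) (sym (interleave-length Cₙ⋈Cₗ))
    (PsiBounded-antitone (length-π₁-interleaving Cₙ⋈Cₗ)
      (PsiBounded-+ (PsiBounded-pickedNow !Cₙ pickedNow)
                    (Satisfies⇒PsiBounded !Cₗ (LeavesWithin-delSet1 T⊆x∷s) pickedLater)))

mainTheorem8 : (X : List ℕ) (T : TreeSet) (C : List (ℕ × ℕ)) (s : List ℕ)
    → Unique X
    → T ≢ []
    → All (λ t → leaves t ↭ X) T
    → Unique C
    → IsConstraintSet T C
    → s ↭ X
    → CPS T s
    → Satisfies T s C
    → PsiBound (weight T s) (length C) (length (π₁ C))
mainTheorem8 X T C s _ _ leaves↭X !C _ s↭X _ sat =
  PsiBounded.unwrap (Satisfies⇒PsiBounded !C T⊆s sat)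
  where
  T⊆s : LeavesWithin T s
  T⊆s = All.map (λ t↭X {_} → ⊆-reflexive-↭ (↭-trans t↭X (↭-sym s↭X))) leaves↭X
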